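{- Let $\mathfrak A$ and $\mathfrak B$ be structures in the same language such that there is a surjective homomorphism from $\mathfrak A^{\mathrm{per}}$ onto $\mathfrak B$. Then every positive Horn sentence true in $\mathfrak A$ is true in $\mathfrak B$.
   Context: Structures are in a countable first-order language (relation, constant, function symbols allowed; equality and $\bot$ included). A positive Horn sentence is built from atomic formulas using only $\wedge,\exists,\forall$. A function $\vec a:\mathbb N\to A$ is periodic if for some $k\ge1$, $\vec a(i)=\vec a(i\bmod k)$ for all $i$; the periodic power $\mathfrak A^{\mathrm{per}}$ is the substructure of the direct power $\mathfrak A^{\mathbb N}$ on the set of periodic functions. -}

module Defs where

open import Data.Nat using (ℕ; zero; suc; _*_; _%_; NonZero)
open import Data.Nat.Properties using (m*n≢0)
open import Data.Nat.Divisibility using (_∣_; ∣-trans; m∣m*n; n∣m*n)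
open import Data.Nat.DivMod using (m∣n⇒o%n%m≡o%m)
open import Data.Fin using (Fin; zero; suc)
open import Data.Product using (Σ; ∃; _,_; proj₁; proj₂)
open import Data.Empty using (⊥)
open import Function using (_∘_; Injective)
open import Relation.Binary.Core using (Rel)
open import Relation.Binary.Structures using (IsEquivalence)
open import Relation.Binary.PropositionalEquality using (_≡_; subst)

-- Countable first-order languages (relation and function symbols;
-- constants are 0-ary function symbols).  Equality and ⊥ are logical.

record Language : Set₁ where
  field
    RelSym  : Set
    FunSym  : Set
    relAr   : RelSym → ℕ
    funAr   : FunSym → ℕ
    -- countability: injections of the symbol sets into ℕ
    encRel  : RelSym → ℕ
    encRel-inj : Injective _≡_ _≡_ encRel
    encFun  : FunSym → ℕ
    encFun-inj : Injective _≡_ _≡_ encFun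

-- Structures.  The domain is a setoid (so that substructures of powers,
-- whose elements are functions, have the right equality); relations and
-- operations respect the equality.

record Structure (L : Language) : Set₁ where
  open Language L
  field
    Carrier : Set
    _≈_     : Rel Carrier _
    isEquiv : IsEquivalence _≈_
    rel     : (r : RelSym) → (Fin (relAr r) → Carrier) → Set
    fun     : (f : FunSym) → (Fin (funAr f) → Carrier) → Carrier
    rel-resp : ∀ r {xs ys} → (∀ i → xs i ≈ ys i) → rel r xs → rel r ys
    fun-cong : ∀ f {xs ys} → (∀ i → xs i ≈ ys i) → fun f xs ≈ fun f ys
  open IsEquivalence isEquiv public

module _ (L : Language) where
  open Language L

  data Term (n : ℕ) : Set where
    var : Fin n → Term n
    app : (f : FunSym) → (Fin (funAr f) → Term n) → Term n

  data PosHorn (n : ℕ) : Set where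
    atom : (r : RelSym) → (Fin (relAr r) → Term n) → PosHorn n
    eq   : Term n → Term n → PosHorn n
    bot  : PosHorn n
    and  : PosHorn n → PosHorn n → PosHorn n
    ex   : PosHorn (suc n) → PosHorn n
    all  : PosHorn (suc n) → PosHorn n

  PosHornSentence : Set
  PosHornSentence = PosHorn 0

module _ {L : Language} (𝔄 : Structure L) where
  open Language L
  open Structure 𝔄

  extend : ∀ {n} → Carrier → (Fin n → Carrier) → Fin (suc n) → Carrier
  extend a ρ zero    = a
  extend a ρ (suc i) = ρ i

  evalTerm : ∀ {n} → (Fin n → Carrier) → Term L n → Carrier
  evalTerm ρ (var i)    = ρ i
  evalTerm ρ (app f ts) = fun f (λ j → evalTerm ρ (ts j))

  Sat : ∀ {n} → (Fin n → Carrier) → PosHorn L n → Set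
  Sat ρ (atom r ts) = rel r (λ j → evalTerm ρ (ts j))
  Sat ρ (eq s t)    = evalTerm ρ s ≈ evalTerm ρ t
  Sat ρ bot         = ⊥
  Sat ρ (and φ ψ)   = Σ (Sat ρ φ) (λ _ → Sat ρ ψ)
  Sat ρ (ex φ)      = Σ Carrier (λ a → Sat (extend a ρ) φ)
  Sat ρ (all φ)     = (a : Carrier) → Sat (extend a ρ) φ

  _⊨_ : PosHornSentence L → Set
  _⊨_ φ = Sat (λ ()) φ

module _ {L : Language} (𝔄 : Structure L) where
  open Language L
  open Structure 𝔄

  Periodic : (ℕ → Carrier) → Set
  Periodic a = Σ ℕ λ k → Σ (NonZero k) λ nz → ∀ i → a i ≈ a ((i % k) {{nz}})

private
  prod : ∀ {n} → (Fin n → ℕ) → ℕ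
  prod {zero}  ks = 1
  prod {suc n} ks = ks zero * prod (ks ∘ suc)

  prod-nz : ∀ {n} (ks : Fin n → ℕ) → (∀ j → NonZero (ks j)) → NonZero (prod ks)
  prod-nz {zero}  ks nz = _
  prod-nz {suc n} ks nz =
    m*n≢0 (ks zero) (prod (ks ∘ suc)) {{nz zero}} {{prod-nz (ks ∘ suc) (nz ∘ suc)}}

  prod-div : ∀ {n} (ks : Fin n → ℕ) j → ks j ∣ prod ks
  prod-div {suc n} ks zero    = m∣m*n (prod (ks ∘ suc))
  prod-div {suc n} ks (suc j) = ∣-trans (prod-div (ks ∘ suc) j) (n∣m*n (ks zero))

module _ {L : Language} (𝔄 : Structure L) where
  open Language L
  open Structure 𝔄

  PerElem : Set
  PerElem = Σ (ℕ → Carrier) (Periodic 𝔄)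

  periodic-fun : (f : FunSym) (xs : Fin (funAr f) → PerElem) →
                 Periodic 𝔄 (λ i → fun f (λ j → proj₁ (xs j) i))
  periodic-fun f xs = Q , nzQ , λ i → fun-cong f (λ j → step j i)
    where
    ks : Fin (funAr f) → ℕ
    ks j = proj₁ (proj₂ (xs j))
    Q : ℕ
    Q = prod ks
    nzQ : NonZero Q
    nzQ = prod-nz ks (λ j → proj₁ (proj₂ (proj₂ (xs j))))
    step : ∀ j i → proj₁ (xs j) i ≈ proj₁ (xs j) ((i % Q) {{nzQ}})
    step j i =
      let a  = proj₁ (xs j)
          nz = proj₁ (proj₂ (proj₂ (xs j)))
          p  = proj₂ (proj₂ (proj₂ (xs j)))
          e  = m∣n⇒o%n%m≡o%m (ks j) Q i {{nz}} {{nzQ}} (prod-div ks j)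
      in trans (p i) (sym (subst (λ m → a ((i % Q) {{nzQ}}) ≈ a m) e (p ((i % Q) {{nzQ}}))))

  PeriodicPower : Structure L
  PeriodicPower = record
    { Carrier  = PerElem
    ; _≈_      = λ a b → ∀ i → proj₁ a i ≈ proj₁ b i
    ; isEquiv  = record { refl = λ i → refl ; sym = λ p i → sym (p i)
                        ; trans = λ p q i → trans (p i) (q i) }
    ; rel      = λ r xs → ∀ i → rel r (λ j → proj₁ (xs j) i)
    ; fun      = λ f xs → (λ i → fun f (λ j → proj₁ (xs j) i)) , periodic-fun f xs
    ; rel-resp = λ r p h i → rel-resp r (λ j → p j i) (h i)
    ; fun-cong = λ f p i → fun-cong f (λ j → p j i)
    }

record Homomorphism {L : Language} (𝔄 𝔅 : Structure L) : Set where
  open Language L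
  module A = Structure 𝔄
  module B = Structure 𝔅
  field
    map      : A.Carrier → B.Carrier
    map-cong : ∀ {x y} → x A.≈ y → map x B.≈ map y
    map-fun  : ∀ f xs → map (A.fun f xs) B.≈ B.fun f (λ j → map (xs j))
    map-rel  : ∀ r xs → A.rel r xs → B.rel r (λ j → map (xs j))

Surjective : {L : Language} {𝔄 𝔅 : Structure L} → Homomorphism 𝔄 𝔅 → Set
Surjective {𝔄 = 𝔄} {𝔅} h =
  ∀ (b : Structure.Carrier 𝔅) → Σ (Structure.Carrier 𝔄) λ a →
    Structure._≈_ 𝔅 (Homomorphism.map h a) b

-- A positive Horn formula holding at every coordinate of a tuple of periodic
-- functions with a common period k holds in the periodic power: an
-- existential witness chosen at coordinate i mod k is again periodic, and a
-- universally quantified periodic element of period m keeps the tuple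
-- periodic with period k * m. So 𝔄 ⊨ φ gives 𝔄^per ⊨ φ, and positive Horn
-- formulas are preserved by surjective homomorphisms (surjectivity handles ∀).
module Submission where

open import Defs
open import Data.Product using (Σ; _,_; proj₁; proj₂)
open import Data.Nat using (ℕ; _*_; _%_; NonZero)
open import Data.Nat.Properties using (m*n≢0)
open import Data.Nat.Divisibility using (_∣_; m∣m*n; n∣m*n)
open import Data.Nat.DivMod using (m∣n⇒o%n%m≡o%m; m%n%n≡m%n)
open import Data.Fin using (Fin; zero; suc)
open import Relation.Binary.PropositionalEquality using (subst; cong) renaming (sym to sym≡)

module _ {L : Language} (𝔄 : Structure L) where
  open Structure 𝔄

  extend-cong : ∀ {n a b} {ρ σ : Fin n → Carrier} → a ≈ b → (∀ j → ρ j ≈ σ j) →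
                ∀ j → extend 𝔄 a ρ j ≈ extend 𝔄 b σ j
  extend-cong a≈b ρ≈σ zero    = a≈b
  extend-cong a≈b ρ≈σ (suc j) = ρ≈σ j

  evalTerm-cong : ∀ {n} {ρ σ : Fin n → Carrier} → (∀ j → ρ j ≈ σ j) →
                  ∀ t → evalTerm 𝔄 ρ t ≈ evalTerm 𝔄 σ t
  evalTerm-cong ρ≈σ (var i)    = ρ≈σ i
  evalTerm-cong ρ≈σ (app f ts) = fun-cong f (λ j → evalTerm-cong ρ≈σ (ts j))

  Sat-cong : ∀ {n} {ρ σ : Fin n → Carrier} → (∀ j → ρ j ≈ σ j) →
             ∀ φ → Sat 𝔄 ρ φ → Sat 𝔄 σ φ
  Sat-cong ρ≈σ (atom r ts) h       = rel-resp r (λ j → evalTerm-cong ρ≈σ (ts j)) h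
  Sat-cong ρ≈σ (eq s t) h          = trans (sym (evalTerm-cong ρ≈σ s)) (trans h (evalTerm-cong ρ≈σ t))
  Sat-cong ρ≈σ (and φ ψ) (hφ , hψ) = Sat-cong ρ≈σ φ hφ , Sat-cong ρ≈σ ψ hψ
  Sat-cong ρ≈σ (ex φ) (a , h)      = a , Sat-cong (extend-cong refl ρ≈σ) φ h
  Sat-cong ρ≈σ (all φ) h a         = Sat-cong (extend-cong refl ρ≈σ) φ (h a)

module _ {L : Language} {𝔄 𝔅 : Structure L} (h : Homomorphism 𝔄 𝔅) where
  open Structure 𝔅
  open Homomorphism h

  evalTerm-homo : ∀ {n} (ρ : Fin n → A.Carrier) t →
                  map (evalTerm 𝔄 ρ t) ≈ evalTerm 𝔅 (λ j → map (ρ j)) t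
  evalTerm-homo ρ (var i)    = refl
  evalTerm-homo ρ (app f ts) = trans (map-fun f _) (fun-cong f (λ j → evalTerm-homo ρ (ts j)))

  extend-homo : ∀ {n} a (ρ : Fin n → A.Carrier) j →
                map (extend 𝔄 a ρ j) ≈ extend 𝔅 (map a) (λ i → map (ρ i)) j
  extend-homo a ρ zero    = refl
  extend-homo a ρ (suc j) = refl

  Sat-surjectiveHomo : Surjective h → ∀ {n} (φ : PosHorn L n) (ρ : Fin n → A.Carrier) →
                       Sat 𝔄 ρ φ → Sat 𝔅 (λ j → map (ρ j)) φ
  Sat-surjectiveHomo sur (atom r ts) ρ s = rel-resp r (λ j → evalTerm-homo ρ (ts j)) (map-rel r _ s)
  Sat-surjectiveHomo sur (eq s t) ρ e    =
    trans (sym (evalTerm-homo ρ s)) (trans (map-cong e) (evalTerm-homo ρ t))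
  Sat-surjectiveHomo sur (and φ ψ) ρ (sφ , sψ) =
    Sat-surjectiveHomo sur φ ρ sφ , Sat-surjectiveHomo sur ψ ρ sψ
  Sat-surjectiveHomo sur (ex φ) ρ (a , s) =
    map a , Sat-cong 𝔅 (extend-homo a ρ) φ (Sat-surjectiveHomo sur φ _ s)
  Sat-surjectiveHomo sur (all φ) ρ s b with sur b
  ... | a , ha≈b =
    Sat-cong 𝔅 (λ j → trans (extend-homo a ρ j) (extend-cong 𝔅 ha≈b (λ _ → refl) j)) φ
      (Sat-surjectiveHomo sur φ _ (s a))

module _ {L : Language} (𝔄 : Structure L) where
  open Structure 𝔄
  private
    𝔄ᵖ = PeriodicPower 𝔄
    module 𝔄ᵖ = Structure 𝔄ᵖ

  coordinate : ∀ {n} → (Fin n → 𝔄ᵖ.Carrier) → ℕ → Fin n → Carrier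
  coordinate ρ i j = proj₁ (ρ j) i

  evalTerm-coordinate : ∀ {n} (ρ : Fin n → 𝔄ᵖ.Carrier) i t →
                        proj₁ (evalTerm 𝔄ᵖ ρ t) i ≈ evalTerm 𝔄 (coordinate ρ i) t
  evalTerm-coordinate ρ i (var x)    = refl
  evalTerm-coordinate ρ i (app f ts) = fun-cong f (λ j → evalTerm-coordinate ρ i (ts j))

  coordinate-extend : ∀ {n} a (ρ : Fin n → 𝔄ᵖ.Carrier) i j →
                      extend 𝔄 (proj₁ a i) (coordinate ρ i) j ≈ coordinate (extend 𝔄ᵖ a ρ) i j
  coordinate-extend a ρ i zero    = refl
  coordinate-extend a ρ i (suc j) = refl

  HasPeriod : (k : ℕ) → .{{NonZero k}} → (ℕ → Carrier) → Set
  HasPeriod k a = ∀ i → a i ≈ a (i % k)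

  HasPeriod-∣ : ∀ {k m} .{{_ : NonZero k}} .{{_ : NonZero m}} → k ∣ m →
                ∀ a → HasPeriod k a → HasPeriod m a
  HasPeriod-∣ {k} {m} k∣m a per i =
    trans (per i) (sym (subst (λ x → a (i % m) ≈ a x) (m∣n⇒o%n%m≡o%m k m i k∣m) (per (i % m))))

  HasPeriod-% : ∀ k .{{_ : NonZero k}} (w : ℕ → Carrier) → HasPeriod k (λ i → w (i % k))
  HasPeriod-% k w i = reflexive (cong w (sym≡ (m%n%n≡m%n i k)))

  CommonPeriod : ∀ {n} (k : ℕ) → .{{NonZero k}} → (Fin n → 𝔄ᵖ.Carrier) → Set
  CommonPeriod k ρ = ∀ j → HasPeriod k (proj₁ (ρ j))

  Sat-periodicPower : ∀ {n} (φ : PosHorn L n) k {{_ : NonZero k}} (ρ : Fin n → 𝔄ᵖ.Carrier) →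
                      CommonPeriod k ρ → (∀ i → Sat 𝔄 (coordinate ρ i) φ) → Sat 𝔄ᵖ ρ φ
  Sat-periodicPower (atom r ts) k ρ per h i = rel-resp r (λ j → sym (evalTerm-coordinate ρ i (ts j))) (h i)
  Sat-periodicPower (eq s t) k ρ per h i    =
    trans (evalTerm-coordinate ρ i s) (trans (h i) (sym (evalTerm-coordinate ρ i t)))
  Sat-periodicPower bot k ρ per h = h 0
  Sat-periodicPower (and φ ψ) k ρ per h =
    Sat-periodicPower φ k ρ per (λ i → proj₁ (h i)) , Sat-periodicPower ψ k ρ per (λ i → proj₂ (h i))
  Sat-periodicPower (ex φ) k {{k≢0}} ρ per h = b , Sat-periodicPower φ k (extend 𝔄ᵖ b ρ) per′ h′
    where
    b : 𝔄ᵖ.Carrier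
    b = (λ i → proj₁ (h (i % k))) , k , k≢0 , HasPeriod-% k (λ i → proj₁ (h i))
    per′ : CommonPeriod k (extend 𝔄ᵖ b ρ)
    per′ zero    = proj₂ (proj₂ (proj₂ b))
    per′ (suc j) = per j
    h′ : ∀ i → Sat 𝔄 (coordinate (extend 𝔄ᵖ b ρ) i) φ
    h′ i = Sat-cong 𝔄 (λ j → trans (extend-cong 𝔄 refl ρ-periodic j) (coordinate-extend b ρ i j))
                     φ (proj₂ (h (i % k)))
      where
      ρ-periodic : ∀ j → coordinate ρ (i % k) j ≈ coordinate ρ i j
      ρ-periodic j = sym (per j i)
  Sat-periodicPower (all φ) k {{k≢0}} ρ per h a@(α , m , m≢0 , perα) =
    Sat-periodicPower φ (k * m) {{k*m≢0}} (extend 𝔄ᵖ a ρ) per′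
      (λ i → Sat-cong 𝔄 (coordinate-extend a ρ i) φ (h i (α i)))
    where
    instance
      k*m≢0 : NonZero (k * m)
      k*m≢0 = m*n≢0 k m {{k≢0}} {{m≢0}}
    per′ : CommonPeriod (k * m) (extend 𝔄ᵖ a ρ)
    per′ zero    = HasPeriod-∣ {{m≢0}} (n∣m*n k) α perα
    per′ (suc j) = HasPeriod-∣ (m∣m*n m) _ (per j)

  ⊨-periodicPower : ∀ φ → 𝔄 ⊨ φ → 𝔄ᵖ ⊨ φ
  ⊨-periodicPower φ 𝔄⊨φ = Sat-periodicPower φ 1 (λ ()) (λ ()) (λ i → Sat-cong 𝔄 (λ ()) φ 𝔄⊨φ)

proposition6p2 : (L : Language) (𝔄 𝔅 : Structure L) →
    Σ (Homomorphism (PeriodicPower 𝔄) 𝔅) Surjective →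
    (φ : PosHornSentence L) → 𝔄 ⊨ φ → 𝔅 ⊨ φ
proposition6p2 L 𝔄 𝔅 (h , sur) φ 𝔄⊨φ =
  Sat-cong 𝔅 (λ ()) φ (Sat-surjectiveHomo h sur φ (λ ()) (⊨-periodicPower 𝔄 φ 𝔄⊨φ))
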